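{- Let $\mathcal{L}$ be the propositional language with constants $\top,\bot,1$ and binary connectives $\wedge,\vee,\otimes,\to$ (no $\nabla$). For every finite sequence $\Gamma$ and formula $A$ of $\mathcal{L}$: $\mathbf{FL}_l\vdash\Gamma\Rightarrow A$ iff $\mathbf{STL}(N)\vdash\Gamma^{\nabla}\Rightarrow A^{\nabla}$, where $\Gamma^\nabla$ is the sequence of translations of the members of $\Gamma$.
   Context: Language $\mathcal{L}_\nabla$: $\mathcal{L}$ extended by a unary $\nabla$. Sequents $\Gamma\Rightarrow A$, $\Gamma$ a finite sequence. $\mathbf{STL}$: axioms $A\Rightarrow A$; $\Rightarrow 1$; $\nabla 1\Rightarrow 1$; $\Gamma\Rightarrow\top$; $\Gamma,\bot,\Sigma\Rightarrow A$. Cut: from $\Gamma\Rightarrow A$ and $\Pi,A,\Sigma\Rightarrow B$ infer $\Pi,\Gamma,\Sigma\Rightarrow B$. $L\wedge$: from $\Gamma,A,\Sigma\Rightarrow C$ infer $\Gamma,A\wedge B,\Sigma\Rightarrow C$ and $\Gamma,B\wedge A,\Sigma\Rightarrow C$. $R\wedge$: from $\Gamma\Rightarrow A$, $\Gamma\Rightarrow B$ infer $\Gamma\Rightarrow A\wedge B$. $L\vee$: from $\Gamma,A,\Sigma\Rightarrow C$ and $\Gamma,B,\Sigma\Rightarrow C$ infer $\Gamma,A\vee B,\Sigma\Rightarrow C$. $R\vee$: from $\Gamma\Rightarrow A$ infer $\Gamma\Rightarrow A\vee B$ and $\Gamma\Rightarrow B\vee A$. $L1$: from $\Gamma,\Sigma\Rightarrow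 A$ infer $\Gamma,1,\Sigma\Rightarrow A$. $L\otimes$: from $\Gamma,A,B,\Sigma\Rightarrow C$ infer $\Gamma,A\otimes B,\Sigma\Rightarrow C$. $R\otimes$: from $\Gamma\Rightarrow A$, $\Sigma\Rightarrow B$ infer $\Gamma,\Sigma\Rightarrow A\otimes B$. $\nabla$: from $A\Rightarrow B$ infer $\nabla A\Rightarrow\nabla B$. Oplax: from $\nabla A,\nabla B\Rightarrow C$ infer $\nabla(A\otimes B)\Rightarrow C$. $L\to$: from $\Gamma\Rightarrow A$ and $\Pi,B,\Sigma\Rightarrow C$ infer $\Pi,\Gamma,\nabla(A\to B),\Sigma\Rightarrow C$. $R\to$: from $A,\nabla\Gamma\Rightarrow B$ infer $\Gamma\Rightarrow A\to B$ ($\nabla\Gamma$ applies $\nabla$ to each member). Schemes: $(N)$ from $\Gamma\Rightarrow A$ infer $\nabla\Gamma\Rightarrow\nabla A$; $(P)$ from $\Gamma\Rightarrow\nabla A$ infer $\Gamma\Rightarrow A$; $(F)$ from $\Gamma\Rightarrow A$ infer $\Gamma\Rightarrow\nabla A$. $\mathbf{STL}(N)$ is $\mathbf{STL}$ plus $(N)$; $\mathbf{FL}_l$ is $\mathbf{STL}$ plus $(P)$ and $(F)$. Write $\Box B$ for $1\to B$. The translation $(-)^\nabla:\mathcal{L}\to\mathcal{L}_\nabla$: $p^\nabla=\nabla\Box p$ for atoms $p$, $\bot^\nabla=\bot$, $\top^\nabla=\nabla\Box\top$, $1^\nabla=1$, $(A\wedge B)^\nabla=\nabla\Box(A^\nabla\wedge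 B^\nabla)$, $(A\vee B)^\nabla=A^\nabla\vee B^\nabla$, $(A\otimes B)^\nabla=A^\nabla\otimes B^\nabla$, $(A\to B)^\nabla=\nabla(A^\nabla\to B^\nabla)$. -}

module Defs where

open import Data.Nat using (ℕ)
open import Data.List using (List; []; _∷_; _++_; [_]; map)
open import Data.Bool using (Bool; true; false)
open import Relation.Binary.PropositionalEquality using (_≡_)

data Fm : Set where
  atom : ℕ → Fm
  ⊤′ ⊥′ 𝟙′ : Fm
  _∧′_ _∨′_ _⊗′_ _⇒′_ : Fm → Fm → Fm

infixr 25 _⇒_
infixr 26 _∨_
infixr 27 _∧_
infixr 28 _⊗_
infix 20 _⊢_⟹_

data Fmᵥ : Set where
  atom : ℕ → Fmᵥ
  ⊤ ⊥ 𝟙 : Fmᵥ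
  _∧_ _∨_ _⊗_ _⇒_ : Fmᵥ → Fmᵥ → Fmᵥ
  ∇ : Fmᵥ → Fmᵥ

ι : Fm → Fmᵥ
ι (atom p) = atom p
ι ⊤′ = ⊤
ι ⊥′ = ⊥
ι 𝟙′ = 𝟙
ι (A ∧′ B) = ι A ∧ ι B
ι (A ∨′ B) = ι A ∨ ι B
ι (A ⊗′ B) = ι A ⊗ ι B
ι (A ⇒′ B) = ι A ⇒ ι B

Ctx : Set
Ctx = List Fmᵥ

□ : Fmᵥ → Fmᵥ
□ B = 𝟙 ⇒ B

record Schemes : Set where
  field
    N P F : Bool
open Schemes

data _⊢_⟹_ (S : Schemes) : Ctx → Fmᵥ → Set where
  ax    : ∀ {A} → S ⊢ [ A ] ⟹ A
  R1    : S ⊢ [] ⟹ 𝟙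
  ∇1    : S ⊢ [ ∇ 𝟙 ] ⟹ 𝟙
  R⊤    : ∀ {Γ} → S ⊢ Γ ⟹ ⊤
  L⊥    : ∀ {Γ Σ A} → S ⊢ Γ ++ ⊥ ∷ Σ ⟹ A
  cut   : ∀ {Γ Π Σ A B} → S ⊢ Γ ⟹ A → S ⊢ Π ++ A ∷ Σ ⟹ B → S ⊢ Π ++ Γ ++ Σ ⟹ B
  L∧₁   : ∀ {Γ Σ A B C} → S ⊢ Γ ++ A ∷ Σ ⟹ C → S ⊢ Γ ++ (A ∧ B) ∷ Σ ⟹ C
  L∧₂   : ∀ {Γ Σ A B C} → S ⊢ Γ ++ A ∷ Σ ⟹ C → S ⊢ Γ ++ (B ∧ A) ∷ Σ ⟹ C
  R∧    : ∀ {Γ A B} → S ⊢ Γ ⟹ A → S ⊢ Γ ⟹ B → S ⊢ Γ ⟹ A ∧ B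
  L∨    : ∀ {Γ Σ A B C} → S ⊢ Γ ++ A ∷ Σ ⟹ C → S ⊢ Γ ++ B ∷ Σ ⟹ C → S ⊢ Γ ++ (A ∨ B) ∷ Σ ⟹ C
  R∨₁   : ∀ {Γ A B} → S ⊢ Γ ⟹ A → S ⊢ Γ ⟹ A ∨ B
  R∨₂   : ∀ {Γ A B} → S ⊢ Γ ⟹ A → S ⊢ Γ ⟹ B ∨ A
  L1    : ∀ {Γ Σ A} → S ⊢ Γ ++ Σ ⟹ A → S ⊢ Γ ++ 𝟙 ∷ Σ ⟹ A
  L⊗    : ∀ {Γ Σ A B C} → S ⊢ Γ ++ A ∷ B ∷ Σ ⟹ C → S ⊢ Γ ++ (A ⊗ B) ∷ Σ ⟹ C
  R⊗    : ∀ {Γ Σ A B} → S ⊢ Γ ⟹ A → S ⊢ Σ ⟹ B → S ⊢ Γ ++ Σ ⟹ A ⊗ B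
  ∇r    : ∀ {A B} → S ⊢ [ A ] ⟹ B → S ⊢ [ ∇ A ] ⟹ ∇ B
  oplax : ∀ {A B C} → S ⊢ ∇ A ∷ ∇ B ∷ [] ⟹ C → S ⊢ [ ∇ (A ⊗ B) ] ⟹ C
  L⇒    : ∀ {Γ Π Σ A B C} → S ⊢ Γ ⟹ A → S ⊢ Π ++ B ∷ Σ ⟹ C → S ⊢ Π ++ Γ ++ ∇ (A ⇒ B) ∷ Σ ⟹ C
  R⇒    : ∀ {Γ A B} → S ⊢ A ∷ map ∇ Γ ⟹ B → S ⊢ Γ ⟹ A ⇒ B
  schN  : ∀ {Γ A} → N S ≡ true → S ⊢ Γ ⟹ A → S ⊢ map ∇ Γ ⟹ ∇ A
  schP  : ∀ {Γ A} → P S ≡ true → S ⊢ Γ ⟹ ∇ A → S ⊢ Γ ⟹ A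
  schF  : ∀ {Γ A} → F S ≡ true → S ⊢ Γ ⟹ A → S ⊢ Γ ⟹ ∇ A

STL-N : Schemes
STL-N = record { N = true ; P = false ; F = false }

FLl : Schemes
FLl = record { N = false ; P = true ; F = true }

infix 40 _ᵛ
_ᵛ : Fm → Fmᵥ
atom p ᵛ = ∇ (□ (atom p))
⊥′ ᵛ = ⊥
⊤′ ᵛ = ∇ (□ ⊤)
𝟙′ ᵛ = 𝟙
(A ∧′ B) ᵛ = ∇ (□ (A ᵛ ∧ B ᵛ))
(A ∨′ B) ᵛ = A ᵛ ∨ B ᵛ
(A ⊗′ B) ᵛ = A ᵛ ⊗ B ᵛ
(A ⇒′ B) ᵛ = ∇ (A ᵛ ⇒ B ᵛ)

module Submission where

-- We extend the translation to a map τ on all of L_∇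
-- by letting it forget ∇ (τ (∇ A) = τ A); on L it agrees with (-)^∇.  Every
-- τ-formula is built from ∇-formulas, ⊥ and 1 by ∨ and ⊗, and contexts of
-- such formulas are "boxable": from F, τΔ ⇒ G one gets τΔ ⇒ ∇(F → G),
-- since the context can be decomposed by invertible left rules until only
-- ∇-formulas remain, where R→ followed by (N) applies.  With this, every
-- rule of any of the calculi is simulated on τ-images in STL(N), in
-- particular the rules R→, R∧, R⊤ and the schemes (P), (F), (N).
--
-- STL(N) is contained in FL_l, since (N) is derivable
-- there from (F) and (P).  In FL_l, ∇A ⇔ A and □A ⇔ A, so by monotonicity of
-- the connectives ι A ⇔ A^∇ for every A of L; replacing the context and
-- cutting against the succedent yields the claim.

open import Defs
open Schemes using (N)
open import Data.List using (List; []; _∷_; _++_; [_]; map)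
open import Data.List.Properties using (map-++; map-∘; map-cong; map-id; ++-assoc; ++-identityʳ)
open import Data.Bool using (true)
open import Function.Bundles using (_⇔_; mk⇔)
open import Relation.Binary.PropositionalEquality
  using (_≡_; refl; sym; trans; cong; cong₂; subst)

castˡ : ∀ {S Δ Δ′ B} → Δ ≡ Δ′ → S ⊢ Δ ⟹ B → S ⊢ Δ′ ⟹ B
castˡ {S} {B = B} = subst (λ X → S ⊢ X ⟹ B)

castʳ : ∀ {S Δ B B′} → B ≡ B′ → S ⊢ Δ ⟹ B → S ⊢ Δ ⟹ B′
castʳ {S} {Δ} = subst (λ X → S ⊢ Δ ⟹ X)

cut-end : ∀ {S Δ A B} → S ⊢ Δ ⟹ A → S ⊢ [ A ] ⟹ B → S ⊢ Δ ⟹ B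
cut-end {Δ = Δ} d e = castˡ (++-identityʳ Δ) (cut {Π = []} {Σ = []} d e)

replace : ∀ {S Π Σ X Y C} → S ⊢ [ Y ] ⟹ X → S ⊢ Π ++ X ∷ Σ ⟹ C → S ⊢ Π ++ Y ∷ Σ ⟹ C
replace {Π = Π} {Σ} e d = cut {Π = Π} {Σ = Σ} e d

replace-map : ∀ {S B} {X : Set} (f g : X → Fmᵥ) → (∀ x → S ⊢ [ g x ] ⟹ f x) →
              ∀ Π xs → S ⊢ Π ++ map f xs ⟹ B → S ⊢ Π ++ map g xs ⟹ B
replace-map f g h Π [] d = d
replace-map f g h Π (x ∷ xs) d =
  castˡ (++-assoc Π [ g x ] (map g xs))
    (replace-map f g h (Π ++ [ g x ]) xs
      (castˡ (sym (++-assoc Π [ g x ] (map f xs))) (replace {Π = Π} (h x) d)))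

∧-mono : ∀ {S A A′ B B′} → S ⊢ [ A ] ⟹ A′ → S ⊢ [ B ] ⟹ B′ → S ⊢ [ A ∧ B ] ⟹ A′ ∧ B′
∧-mono d e = R∧ (L∧₁ {Γ = []} d) (L∧₂ {Γ = []} e)

∨-mono : ∀ {S A A′ B B′} → S ⊢ [ A ] ⟹ A′ → S ⊢ [ B ] ⟹ B′ → S ⊢ [ A ∨ B ] ⟹ A′ ∨ B′
∨-mono d e = L∨ {Γ = []} (R∨₁ d) (R∨₂ e)

⊗-mono : ∀ {S A A′ B B′} → S ⊢ [ A ] ⟹ A′ → S ⊢ [ B ] ⟹ B′ → S ⊢ [ A ⊗ B ] ⟹ A′ ⊗ B′
⊗-mono d e = L⊗ {Γ = []} (R⊗ d e)

⇒-mono : ∀ {S A A′ B B′} → S ⊢ [ A′ ] ⟹ A → S ⊢ [ B ] ⟹ B′ → S ⊢ [ A ⇒ B ] ⟹ A′ ⇒ B′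
⇒-mono {A′ = A′} d e = R⇒ (L⇒ {Γ = [ A′ ]} {Π = []} {Σ = []} d e)

τ : Fmᵥ → Fmᵥ
τ (atom p) = ∇ (□ (atom p))
τ ⊤ = ∇ (□ ⊤)
τ ⊥ = ⊥
τ 𝟙 = 𝟙
τ (A ∧ B) = ∇ (□ (τ A ∧ τ B))
τ (A ∨ B) = τ A ∨ τ B
τ (A ⊗ B) = τ A ⊗ τ B
τ (A ⇒ B) = ∇ (τ A ⇒ τ B)
τ (∇ A) = τ A

τ-ι : ∀ A → τ (ι A) ≡ A ᵛ
τ-ι (atom p) = refl
τ-ι ⊤′ = refl
τ-ι ⊥′ = refl
τ-ι 𝟙′ = refl
τ-ι (A ∧′ B) = cong₂ (λ X Y → ∇ (□ (X ∧ Y))) (τ-ι A) (τ-ι B)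
τ-ι (A ∨′ B) = cong₂ _∨_ (τ-ι A) (τ-ι B)
τ-ι (A ⊗′ B) = cong₂ _⊗_ (τ-ι A) (τ-ι B)
τ-ι (A ⇒′ B) = cong₂ (λ X Y → ∇ (X ⇒ Y)) (τ-ι A) (τ-ι B)

map-τ-ι : ∀ Γ → map τ (map ι Γ) ≡ map _ᵛ Γ
map-τ-ι Γ = trans (sym (map-∘ Γ)) (map-cong τ-ι Γ)

Boxable : Schemes → Ctx → Set
Boxable S Δ = ∀ Γ {F G} → S ⊢ F ∷ map ∇ Γ ++ Δ ⟹ G → S ⊢ map ∇ Γ ++ Δ ⟹ ∇ (F ⇒ G)

-- With (N) the empty remainder is boxable: the whole context is then of
-- the form ∇Γ, so R→ followed by (N) applies.
boxable-[] : ∀ {S} → N S ≡ true → Boxable S []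
boxable-[] hasN Γ {F} d =
  castˡ (sym (++-identityʳ (map ∇ Γ)))
    (schN hasN (R⇒ (castˡ (cong (F ∷_) (++-identityʳ (map ∇ Γ))) d)))

boxable-∇ : ∀ {S Δ D} → Boxable S Δ → Boxable S (∇ D ∷ Δ)
boxable-∇ {Δ = Δ} {D} b Γ {F} d =
  castˡ shift (b (Γ ++ [ D ]) (castˡ (cong (F ∷_) (sym shift)) d))
  where
  shift : map ∇ (Γ ++ [ D ]) ++ Δ ≡ map ∇ Γ ++ ∇ D ∷ Δ
  shift = trans (cong (_++ Δ) (map-++ ∇ Γ [ D ])) (++-assoc (map ∇ Γ) [ ∇ D ] Δ)

-- The remaining closure properties use that L⊥, L1, L∨ and L⊗ are invertible.
boxable-⊥ : ∀ {S Δ} → Boxable S (⊥ ∷ Δ)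
boxable-⊥ Γ d = L⊥ {Γ = map ∇ Γ}

boxable-𝟙 : ∀ {S Δ} → Boxable S Δ → Boxable S (𝟙 ∷ Δ)
boxable-𝟙 {Δ = Δ} b Γ {F} d =
  L1 {Γ = map ∇ Γ} (b Γ (cut {Γ = []} {Π = F ∷ map ∇ Γ} {Σ = Δ} R1 d))

boxable-∨ : ∀ {S Δ A B} → Boxable S (A ∷ Δ) → Boxable S (B ∷ Δ) → Boxable S (A ∨ B ∷ Δ)
boxable-∨ b₁ b₂ Γ {F} d =
  L∨ {Γ = map ∇ Γ}
    (b₁ Γ (replace {Π = F ∷ map ∇ Γ} (R∨₁ ax) d))
    (b₂ Γ (replace {Π = F ∷ map ∇ Γ} (R∨₂ ax) d))

boxable-⊗ : ∀ {S Δ A B} → Boxable S (A ∷ B ∷ Δ) → Boxable S (A ⊗ B ∷ Δ)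
boxable-⊗ {Δ = Δ} {A} {B} b Γ {F} d =
  L⊗ {Γ = map ∇ Γ}
    (b Γ (cut {Γ = A ∷ B ∷ []} {Π = F ∷ map ∇ Γ} {Σ = Δ} (R⊗ {Γ = [ A ]} {Σ = [ B ]} ax ax) d))

-- Every τ-formula is built from ∇-formulas, ⊥ and 1 by ∨ and ⊗.
τ-boxable : ∀ {S Δ} X → Boxable S Δ → Boxable S (τ X ∷ Δ)
τ-boxable (atom p) b = boxable-∇ b
τ-boxable ⊤ b = boxable-∇ b
τ-boxable ⊥ b = boxable-⊥
τ-boxable 𝟙 b = boxable-𝟙 b
τ-boxable (A ∧ B) b = boxable-∇ b
τ-boxable (A ∨ B) b = boxable-∨ (τ-boxable A b) (τ-boxable B b)
τ-boxable (A ⊗ B) b = boxable-⊗ (τ-boxable A (τ-boxable B b))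
τ-boxable (A ⇒ B) b = boxable-∇ b
τ-boxable (∇ A) b = τ-boxable A b

box : ∀ {S} → N S ≡ true → ∀ Δ {F G} → S ⊢ F ∷ map τ Δ ⟹ G → S ⊢ map τ Δ ⟹ ∇ (F ⇒ G)
box hasN Δ = map-τ-boxable Δ []
  where
  map-τ-boxable : ∀ Δ → Boxable _ (map τ Δ)
  map-τ-boxable [] = boxable-[] hasN
  map-τ-boxable (X ∷ Δ) = τ-boxable X (map-τ-boxable Δ)

unbox-L : ∀ {S Π Σ B C} → S ⊢ Π ++ B ∷ Σ ⟹ C → S ⊢ Π ++ ∇ (□ B) ∷ Σ ⟹ C
unbox-L {Π = Π} {Σ} d = L⇒ {Γ = []} {Π = Π} {Σ = Σ} R1 d

module Interpretation {S′ : Schemes} (hasN : N S′ ≡ true) where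

  unfold-at : ∀ {C} Γ X Σ → S′ ⊢ map τ (Γ ++ X ∷ Σ) ⟹ C → S′ ⊢ map τ Γ ++ τ X ∷ map τ Σ ⟹ C
  unfold-at Γ X Σ = castˡ (map-++ τ Γ (X ∷ Σ))

  fold-at : ∀ {C} Γ X Σ → S′ ⊢ map τ Γ ++ τ X ∷ map τ Σ ⟹ C → S′ ⊢ map τ (Γ ++ X ∷ Σ) ⟹ C
  fold-at Γ X Σ = castˡ (sym (map-++ τ Γ (X ∷ Σ)))

  fold-++₃ : ∀ {C} Π Γ Σ → S′ ⊢ map τ Π ++ map τ Γ ++ map τ Σ ⟹ C → S′ ⊢ map τ (Π ++ Γ ++ Σ) ⟹ C
  fold-++₃ Π Γ Σ = castˡ (sym (trans (map-++ τ Π (Γ ++ Σ)) (cong (map τ Π ++_) (map-++ τ Γ Σ))))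

  τ-∇ : ∀ Γ → map τ (map ∇ Γ) ≡ map τ Γ
  τ-∇ Γ = sym (map-∘ Γ)

  interpret : ∀ {S Δ B} → S ⊢ Δ ⟹ B → S′ ⊢ map τ Δ ⟹ τ B
  interpret ax = ax
  interpret R1 = R1
  interpret ∇1 = ax
  interpret (R⊤ {Γ}) = box hasN Γ R⊤
  interpret (L⊥ {Γ} {Σ}) = fold-at Γ ⊥ Σ (L⊥ {Γ = map τ Γ})
  interpret (cut {Γ} {Π} {Σ} {A} d e) =
    fold-++₃ Π Γ Σ (cut {Π = map τ Π} {Σ = map τ Σ} (interpret d) (unfold-at Π A Σ (interpret e)))
  interpret (L∧₁ {Γ} {Σ} {A} {B} d) =
    fold-at Γ (A ∧ B) Σ (unbox-L {Π = map τ Γ} (L∧₁ {Γ = map τ Γ} (unfold-at Γ A Σ (interpret d))))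
  interpret (L∧₂ {Γ} {Σ} {A} {B} d) =
    fold-at Γ (B ∧ A) Σ (unbox-L {Π = map τ Γ} (L∧₂ {Γ = map τ Γ} (unfold-at Γ A Σ (interpret d))))
  interpret (R∧ {Γ} d e) = box hasN Γ (L1 {Γ = []} (R∧ (interpret d) (interpret e)))
  interpret (L∨ {Γ} {Σ} {A} {B} d e) =
    fold-at Γ (A ∨ B) Σ
      (L∨ {Γ = map τ Γ} (unfold-at Γ A Σ (interpret d)) (unfold-at Γ B Σ (interpret e)))
  interpret (R∨₁ d) = R∨₁ (interpret d)
  interpret (R∨₂ d) = R∨₂ (interpret d)
  interpret (L1 {Γ} {Σ} d) = fold-at Γ 𝟙 Σ (L1 {Γ = map τ Γ} (castˡ (map-++ τ Γ Σ) (interpret d)))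
  interpret (L⊗ {Γ} {Σ} {A} {B} d) =
    fold-at Γ (A ⊗ B) Σ (L⊗ {Γ = map τ Γ} (unfold-at Γ A (B ∷ Σ) (interpret d)))
  interpret (R⊗ {Γ} {Σ} d e) = castˡ (sym (map-++ τ Γ Σ)) (R⊗ (interpret d) (interpret e))
  interpret (∇r d) = interpret d
  interpret (oplax d) = L⊗ {Γ = []} (interpret d)
  interpret (L⇒ {Γ} {Π} {Σ} {A} {B} d e) =
    fold-++₃ Π Γ (∇ (A ⇒ B) ∷ Σ)
      (L⇒ {Π = map τ Π} {Σ = map τ Σ} (interpret d) (unfold-at Π B Σ (interpret e)))
  interpret (R⇒ {Γ} {A} d) = box hasN Γ (castˡ (cong (τ A ∷_) (τ-∇ Γ)) (interpret d))
  interpret (schN {Γ} _ d) = castˡ (sym (τ-∇ Γ)) (interpret d)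
  interpret (schP _ d) = interpret d
  interpret (schF _ d) = interpret d

open Interpretation using (interpret)

∇-elim : ∀ X → FLl ⊢ [ ∇ X ] ⟹ X
∇-elim X = schP refl ax

∇-intro : ∀ X → FLl ⊢ [ X ] ⟹ ∇ X
∇-intro X = schF refl ax

□-elim : ∀ X → FLl ⊢ [ □ X ] ⟹ X
□-elim X = cut-end (∇-intro (□ X)) (unbox-L {Π = []} {Σ = []} ax)

□-intro : ∀ X → FLl ⊢ [ X ] ⟹ □ X
□-intro X = R⇒ (L1 {Γ = []} (∇-elim X))

-- The scheme (N) is admissible in FL_l: apply (F), then weaken each
-- hypothesis to its ∇-form.
N-admissible : ∀ {Γ A} → FLl ⊢ Γ ⟹ A → FLl ⊢ map ∇ Γ ⟹ ∇ A
N-admissible {Γ} d = replace-map (λ X → X) ∇ ∇-elim [] Γ (castˡ (sym (map-id Γ)) (schF refl d))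

embed : ∀ {Δ B} → STL-N ⊢ Δ ⟹ B → FLl ⊢ Δ ⟹ B
embed ax = ax
embed R1 = R1
embed ∇1 = ∇1
embed R⊤ = R⊤
embed (L⊥ {Γ}) = L⊥ {Γ = Γ}
embed (cut {Γ} {Π} {Σ} d e) = cut {Γ = Γ} {Π = Π} {Σ = Σ} (embed d) (embed e)
embed (L∧₁ {Γ} d) = L∧₁ {Γ = Γ} (embed d)
embed (L∧₂ {Γ} d) = L∧₂ {Γ = Γ} (embed d)
embed (R∧ d e) = R∧ (embed d) (embed e)
embed (L∨ {Γ} d e) = L∨ {Γ = Γ} (embed d) (embed e)
embed (R∨₁ d) = R∨₁ (embed d)
embed (R∨₂ d) = R∨₂ (embed d)
embed (L1 {Γ} d) = L1 {Γ = Γ} (embed d)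
embed (L⊗ {Γ} d) = L⊗ {Γ = Γ} (embed d)
embed (R⊗ d e) = R⊗ (embed d) (embed e)
embed (∇r d) = ∇r (embed d)
embed (oplax d) = oplax (embed d)
embed (L⇒ {Γ} {Π} {Σ} d e) = L⇒ {Γ = Γ} {Π = Π} {Σ = Σ} (embed d) (embed e)
embed (R⇒ d) = R⇒ (embed d)
embed (schN _ d) = N-admissible (embed d)

ι⊢ᵛ : ∀ A → FLl ⊢ [ ι A ] ⟹ A ᵛ
ᵛ⊢ι : ∀ A → FLl ⊢ [ A ᵛ ] ⟹ ι A

ι⊢ᵛ (atom p) = cut-end (□-intro _) (∇-intro _)
ι⊢ᵛ ⊤′ = cut-end (□-intro _) (∇-intro _)
ι⊢ᵛ ⊥′ = ax
ι⊢ᵛ 𝟙′ = ax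
ι⊢ᵛ (A ∧′ B) = cut-end (∧-mono (ι⊢ᵛ A) (ι⊢ᵛ B)) (cut-end (□-intro _) (∇-intro _))
ι⊢ᵛ (A ∨′ B) = ∨-mono (ι⊢ᵛ A) (ι⊢ᵛ B)
ι⊢ᵛ (A ⊗′ B) = ⊗-mono (ι⊢ᵛ A) (ι⊢ᵛ B)
ι⊢ᵛ (A ⇒′ B) = cut-end (⇒-mono (ᵛ⊢ι A) (ι⊢ᵛ B)) (∇-intro _)

ᵛ⊢ι (atom p) = cut-end (∇-elim _) (□-elim _)
ᵛ⊢ι ⊤′ = R⊤
ᵛ⊢ι ⊥′ = ax
ᵛ⊢ι 𝟙′ = ax
ᵛ⊢ι (A ∧′ B) = cut-end (∇-elim _) (cut-end (□-elim _) (∧-mono (ᵛ⊢ι A) (ᵛ⊢ι B)))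
ᵛ⊢ι (A ∨′ B) = ∨-mono (ᵛ⊢ι A) (ᵛ⊢ι B)
ᵛ⊢ι (A ⊗′ B) = ⊗-mono (ᵛ⊢ι A) (ᵛ⊢ι B)
ᵛ⊢ι (A ⇒′ B) = cut-end (∇-elim _) (⇒-mono (ι⊢ᵛ A) (ᵛ⊢ι B))

theorem7p14 : (Γ : List Fm) (A : Fm) →
    (FLl ⊢ map ι Γ ⟹ ι A) ⇔ (STL-N ⊢ map _ᵛ Γ ⟹ A ᵛ)
theorem7p14 Γ A = mk⇔ forward backward
  where
  forward : FLl ⊢ map ι Γ ⟹ ι A → STL-N ⊢ map _ᵛ Γ ⟹ A ᵛ
  forward d = castʳ (τ-ι A) (castˡ (map-τ-ι Γ) (interpret refl d))

  backward : STL-N ⊢ map _ᵛ Γ ⟹ A ᵛ → FLl ⊢ map ι Γ ⟹ ι A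
  backward d = cut-end (replace-map _ᵛ ι ι⊢ᵛ [] Γ (embed d)) (ᵛ⊢ι A)
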